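{- For every $k \in \mathbb{N}$ there is a finite bidirected graph $B_k$ and a set $F_k$ of edges of $B_k$ such that (1) for every collection $\mathcal{C}$ of pairwise edge-disjoint cycles in $B_k$, we have $|F_k \cap E(\mathcal{C})| \leq 1$; and (2) for every edge set $X_k \subseteq E(B_k)$ with $|X_k| \le k$, the bidirected graph $B_k - X_k$ contains a cycle containing an edge of $F_k$.
   Context: A bidirected graph $B=(G,\sigma)$ consists of a finite undirected graph $G$, which may have parallel edges but no loops, and a signing $\sigma$ assigning to each half-edge $(u,e)$ (with $e\in E(G)$, $u$ an endpoint of $e$) a sign $+$ or $-$. Vertices, edges, edge-disjointness etc. of $B$ are those of $G$; deleting edges keeps the signs of the remaining half-edges. A cycle in $B$ is a cycle in $G$ such that at every vertex $v$ of the cycle, the two cycle edges incident with $v$ have distinct signs at $v$ (cycles of length 2 through two parallel edges are allowed). For a collection $\mathcal{C}$ of cycles, $E(\mathcal{C})$ is the set of edges lying on some cycle of $\mathcal{C}$. -}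

module Defs where

open import Data.Nat using (ℕ; suc)
open import Data.Bool using (Bool; true; false)
open import Data.Fin using (Fin; zero; suc; _≟_)
open import Data.Fin.Subset using (Subset; _∈_; _∉_; _∩_; ⋃)
open import Data.Vec using (tabulate)
open import Data.List using (List; map)
open import Data.List.Relation.Unary.AllPairs using (AllPairs)
open import Data.Product using (Σ; _×_; _,_; proj₁; proj₂; ∃)
open import Function.Definitions using (Injective)
open import Relation.Binary.PropositionalEquality using (_≡_; _≢_)
open import Relation.Nullary.Decidable using (⌊_⌋)
open import Data.Fin.Properties using (any?)

next : ∀ {l} → Fin (suc l) → Fin (suc l)
next {l} i = Data.Fin.fromℕ< (Data.Nat.DivMod.m%n<n (suc (Data.Fin.toℕ i)) (suc l))
  where import Data.Nat.DivMod

-- Edge e has endpoints (tl e , hd e), which must differ (no loops), and a sign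
-- at each of its two half-edges: tlSign e at (tl e , e), hdSign e at (hd e , e).
-- Signs: true = +, false = -.
record BiGraph : Set where
  field
    n m    : ℕ
    tl hd  : Fin m → Fin n
    noLoop : ∀ e → tl e ≢ hd e
    tlSign hdSign : Fin m → Bool
open BiGraph public

start end : (B : BiGraph) → Fin (m B) → Bool → Fin (n B)
start B e true  = tl B e
start B e false = hd B e
end   B e true  = hd B e
end   B e false = tl B e

startSign endSign : (B : BiGraph) → Fin (m B) → Bool → Bool
startSign B e true  = tlSign B e
startSign B e false = hdSign B e
endSign   B e true  = hdSign B e
endSign   B e false = tlSign B e

-- A cycle of B: cyclic sequence v₀ e₀ v₁ e₁ … v_{L-1} e_{L-1} (v₀), with L ≥ 1,
-- distinct vertices, distinct edges, eᵢ joining vᵢ and vᵢ₊₁ (indices mod L),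
-- and at each vertex vᵢ₊₁ the two cycle edges eᵢ, eᵢ₊₁ have distinct signs.
-- (Since there are no loops, L ≥ 2 automatically; L = 2 uses two parallel edges.)
record Cycle (B : BiGraph) : Set where
  field
    len     : ℕ          -- L = suc len
    vtx     : Fin (suc len) → Fin (n B)
    edg     : Fin (suc len) → Fin (m B)
    dir     : Fin (suc len) → Bool
    vtxInj  : Injective _≡_ _≡_ vtx
    edgInj  : Injective _≡_ _≡_ edg
    startOk : ∀ i → start B (edg i) (dir i) ≡ vtx i
    endOk   : ∀ i → end B (edg i) (dir i) ≡ vtx (next i)
    signOk  : ∀ i → endSign B (edg i) (dir i) ≢ startSign B (edg (next i)) (dir (next i))
open Cycle public

_onCycle_ : {B : BiGraph} → Fin (m B) → Cycle B → Set
e onCycle C = ∃ λ i → edg C i ≡ e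

edgeSet : {B : BiGraph} → Cycle B → Subset (m B)
edgeSet C = tabulate λ e → ⌊ any? (λ i → edg C i ≟ e) ⌋

E : {B : BiGraph} → List (Cycle B) → Subset (m B)
E {B} 𝒞 = ⋃ {m B} (map edgeSet 𝒞)

EdgeDisjoint : {B : BiGraph} → Cycle B → Cycle B → Set
EdgeDisjoint C D = ∀ i j → edg C i ≢ edg D j

PairwiseEdgeDisjoint : {B : BiGraph} → List (Cycle B) → Set
PairwiseEdgeDisjoint = AllPairs EdgeDisjoint

-- A cycle of B - X (deleting edges keeps signs, so these are exactly the
-- cycles of B using no edge of X).
CycleOfDeletion : (B : BiGraph) → Subset (m B) → Set
CycleOfDeletion B X = Σ (Cycle B) λ C → ∀ i → edg C i ∉ X

{-# OPTIONS --safe #-}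
-- The graph B_k is a grid with levels 0..H and columns 0..2H, where H = 2(2k + 1). Each grid point is split
-- into an in-vertex and an out-vertex joined by a spine edge (+ at the in-vertex, - at the out-vertex); from
-- each out-vertex an edge climbs one level to the in-vertex of the same column or of the column to its left
-- (+ below, - above); the F-edges join the out-vertices at the top of columns 2j and 2j + 1 (+ at both ends);
-- and the bottom in-vertex of each column x is joined to a hub (- at the column, + at the hub iff x < H).
--
-- The only negative half-edge at an out-vertex is its spine, and those at an in-vertex lead one level down or
-- to the hub. So from both ends of an F-edge a cycle runs down to the hub along a leg that uses a spine edge on
-- every level and drifts right by at most one column per level. Legs reach the hub after a fixed number of
-- steps and a cycle visits the hub once, so a cycle contains at most one F-edge; its two hub edges have
-- different signs at the hub, so one leg lands left of H and the other does not. If cycles through F-edges j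
-- and j' are edge-disjoint, the left leg of the second lands left of the right leg of the first; sharing no
-- spine edge, the two legs keep this order up to the top, which forces j' <= j. By symmetry j = j', so the two
-- cycles share an F-edge after all.
--
-- Conversely, for each j consider the cycle that leaves the hub, climbs column 2j, crosses F-edge j and
-- descends the diagonal from column 2j + 1 (along which column + level stays H + 2j + 1) back to the hub. Apart
-- from F-edges, an edge lies on this cycle only if its column is 2j or its column + level is H + 2j + 1, so it
-- lies on at most two of these 2k + 1 cycles, and deleting k edges leaves one of them intact.
module Submission where

open import Defs
open import Data.Bool using (Bool; true; false; not; if_then_else_)
open import Data.Bool.Properties using (T-≡; not-injective; ¬-not)
open import Data.Empty using (⊥; ⊥-elim)
open import Data.Fin using (Fin; zero; suc; toℕ; fromℕ; fromℕ<; inject₁) renaming (_≟_ to _≟ᶠ_)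
open import Data.Fin.Properties
  using (any?; +↔⊎; *↔×; 1↔⊤; toℕ-injective; toℕ<n; toℕ≤pred[n]; toℕ-fromℕ; toℕ-fromℕ<; toℕ-inject₁)
open import Data.Fin.Relation.Unary.Top using (view; ‵fromℕ; ‵inject₁)
open import Data.Fin.Subset using (Subset; _∈_; _∉_; _∪_; _∩_; ⁅_⁆; ∣_∣; ∁; inside; outside) renaming (⊥ to ∅)
open import Data.Fin.Subset.Properties
  using (x∈p∪q⁺; x∈p∪q⁻; x∈p∩q⁻; x∈⁅x⁆; x∈∁p⇒x∉p; ∉⊥; ∣⁅x⁆∣≡1; ∣⊥∣≡0; ∣∁p∣≡n∸∣p∣; nonempty?;
         Empty-unique; p⊆q⇒∣p∣≤∣q∣)
open import Data.List using (List; []; _∷_)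
open import Data.List.Relation.Unary.All using (All; _∷_)
open import Data.List.Relation.Unary.AllPairs using (_∷_)
open import Data.List.Relation.Unary.Any using (Any) renaming (here to hereₗ; there to thereₗ)
open import Data.Nat using (ℕ; zero; suc; _+_; _*_; _∸_; _≤_; _<_; z≤n; s≤s; s≤s⁻¹; _<?_; _≡ᵇ_)
open import Data.Nat.DivMod using (_%_; m%n<n; m<n⇒m%n≡m; n%n≡0)
open import Data.Nat.GeneralisedArithmetic using (iterate; fold)
open import Data.Nat.Properties
  using (_≟_; suc-injective; ≡ᵇ⇒≡; ≡⇒≡ᵇ; 1+n≢n; ≤-refl; ≤-reflexive; ≤-antisym; ≤-trans; <-trans; ≤-<-trans; <-≤-trans;
         <-irrefl; n≮n; <⇒≤; <⇒≢; <⇒≱; ≤⇒≯; ≮⇒≥; ≤∧≢⇒<; <⇒≤pred; m≤n⇒m<n∨m≡n; n≤1+n; n<1+n; m≤m+n; m≤n+m;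
         +-assoc; +-comm; +-suc; +-mono-≤; +-cancelˡ-≡; *-monoˡ-≤; n∸n≡0; m∸n≤m; m∸n≡0⇒m≤n; m∸[m∸n]≡n;
         m+[n∸m]≡n; +-∸-assoc)
open import Data.Product using (Σ; ∃; _×_; _,_; proj₁; proj₂)
open import Data.Sum using (_⊎_; inj₁; inj₂)
open import Data.Sum.Function.Propositional using (_⊎-↔_)
open import Data.Unit using (⊤; tt)
open import Data.Vec using (_∷_; []; tabulate; here; there)
open import Data.Vec.Properties using (lookup∘tabulate; []=⇒lookup; lookup⇒[]=)
open import Function.Bundles using (Equivalence; Inverse; Injection; _↔_)
open import Function.Definitions using (Injective)
open import Function.Properties.Inverse using (↔-trans; ↔-sym; ↔⇒↣)
open import Relation.Binary.PropositionalEquality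
  using (_≡_; _≢_; refl; sym; trans; cong; cong₂; subst; subst₂; module ≡-Reasoning)
open import Relation.Nullary using (yes; no; does; contradiction)
open import Relation.Nullary.Decidable using (dec-true; dec-false; toWitness)

-- Recursive, so that double (suc n) is suc (suc (double n)) definitionally; positions on cycles rely on this.
double : ℕ → ℕ
double zero    = zero
double (suc n) = suc (suc (double n))

double-< : ∀ {m n} → m < n → suc (double m) < double n
double-< {zero}  {suc n} _       = s≤s (s≤s z≤n)
double-< {suc m} {suc n} (s≤s p) = s≤s (s≤s (double-< p))

double-cancel-≤ : ∀ {m n} → double m ≤ suc (double n) → m ≤ n
double-cancel-≤ {zero}          _               = z≤n
double-cancel-≤ {suc m} {zero}  (s≤s ())
double-cancel-≤ {suc m} {suc n} (s≤s (s≤s p))   = s≤s (double-cancel-≤ p)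

double-injective : ∀ {m n} → double m ≡ double n → m ≡ n
double-injective {m} {n} eq =
  ≤-antisym (double-cancel-≤ (≤-trans (≤-reflexive eq) (n≤1+n _)))
            (double-cancel-≤ (≤-trans (≤-reflexive (sym eq)) (n≤1+n _)))

next-fromℕ : ∀ l → next (fromℕ l) ≡ zero
next-fromℕ l = toℕ-injective (begin
  toℕ (next (fromℕ l))        ≡⟨ toℕ-fromℕ< (m%n<n (suc (toℕ (fromℕ l))) (suc l)) ⟩
  suc (toℕ (fromℕ l)) % suc l ≡⟨ cong (λ t → suc t % suc l) (toℕ-fromℕ l) ⟩
  suc l % suc l               ≡⟨ n%n≡0 (suc l) ⟩
  0                           ∎)
  where open ≡-Reasoning

next-inject₁ : ∀ {l} (j : Fin l) → next (inject₁ j) ≡ suc j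
next-inject₁ {l} j = toℕ-injective (begin
  toℕ (next (inject₁ j))        ≡⟨ toℕ-fromℕ< (m%n<n (suc (toℕ (inject₁ j))) (suc l)) ⟩
  suc (toℕ (inject₁ j)) % suc l ≡⟨ cong (λ t → suc t % suc l) (toℕ-inject₁ j) ⟩
  suc (toℕ j) % suc l           ≡⟨ m<n⇒m%n≡m (s≤s (toℕ<n j)) ⟩
  suc (toℕ j)                   ∎)
  where open ≡-Reasoning

prev : ∀ {l} → Fin (suc l) → Fin (suc l)
prev {l} zero = fromℕ l
prev (suc j)  = inject₁ j

next-prev : ∀ {l} (i : Fin (suc l)) → next (prev i) ≡ i
next-prev {l} zero = next-fromℕ l
next-prev (suc j)  = next-inject₁ j

prev-next : ∀ {l} (i : Fin (suc l)) → prev (next i) ≡ i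
prev-next i with view i
... | ‵fromℕ      = cong prev (next-fromℕ _)
... | ‵inject₁ j  = cong prev (next-inject₁ j)

next-injective : ∀ {l} {i j : Fin (suc l)} → next i ≡ next j → i ≡ j
next-injective {i = i} {j} eq = trans (sym (prev-next i)) (trans (cong prev eq) (prev-next j))

iterate-injective : ∀ {A : Set} {f : A → A} → (∀ {x y} → f x ≡ f y → x ≡ y) →
                    ∀ n {x y} → iterate f x n ≡ iterate f y n → x ≡ y
iterate-injective f-inj zero    eq = eq
iterate-injective f-inj (suc n) eq = f-inj (iterate-injective f-inj n eq)

clamp : ∀ {n} → ℕ → Fin (suc n)
clamp {zero}  _       = zero
clamp {suc n} zero    = zero
clamp {suc n} (suc x) = suc (clamp x)

toℕ-clamp : ∀ {n x} → x ≤ n → toℕ (clamp {n} x) ≡ x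
toℕ-clamp {zero}  z≤n     = refl
toℕ-clamp {suc n} z≤n     = refl
toℕ-clamp {suc n} (s≤s p) = cong suc (toℕ-clamp p)

inject₁-clamp : ∀ {n x} → x ≤ n → inject₁ (clamp {n} x) ≡ clamp x
inject₁-clamp {zero}  z≤n     = refl
inject₁-clamp {suc n} z≤n     = refl
inject₁-clamp {suc n} (s≤s p) = cong suc (inject₁-clamp p)

clamp-top : ∀ n → clamp {n} n ≡ fromℕ n
clamp-top zero    = refl
clamp-top (suc n) = cong suc (clamp-top n)

∣p∪q∣≤∣p∣+∣q∣ : ∀ {n} (p q : Subset n) → ∣ p ∪ q ∣ ≤ ∣ p ∣ + ∣ q ∣
∣p∪q∣≤∣p∣+∣q∣ []            []            = z≤n
∣p∪q∣≤∣p∣+∣q∣ (outside ∷ p) (outside ∷ q) = ∣p∪q∣≤∣p∣+∣q∣ p q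
∣p∪q∣≤∣p∣+∣q∣ (inside  ∷ p) (outside ∷ q) = s≤s (∣p∪q∣≤∣p∣+∣q∣ p q)
∣p∪q∣≤∣p∣+∣q∣ (outside ∷ p) (inside  ∷ q) =
  ≤-trans (s≤s (∣p∪q∣≤∣p∣+∣q∣ p q)) (≤-reflexive (sym (+-suc _ _)))
∣p∪q∣≤∣p∣+∣q∣ (inside  ∷ p) (inside  ∷ q) =
  s≤s (≤-trans (∣p∪q∣≤∣p∣+∣q∣ p q) (≤-trans (n≤1+n _) (≤-reflexive (sym (+-suc _ _)))))

module _ {n : ℕ} where

  ∣p∣≤1 : (p : Subset n) → (∀ {x y} → x ∈ p → y ∈ p → x ≡ y) → ∣ p ∣ ≤ 1
  ∣p∣≤1 p unique with nonempty? p
  ... | yes (x , x∈p) = ≤-trans (p⊆q⇒∣p∣≤∣q∣ (λ y∈p → subst (_∈ ⁅ x ⁆) (unique x∈p y∈p) (x∈⁅x⁆ x)))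
                                (≤-reflexive (∣⁅x⁆∣≡1 x))
  ... | no empty      = ≤-trans (≤-reflexive (trans (cong ∣_∣ (Empty-unique empty)) (∣⊥∣≡0 n))) z≤n

  ∣p∣<n⇒∃∉ : (p : Subset n) → ∣ p ∣ < n → ∃ λ x → x ∉ p
  ∣p∣<n⇒∃∉ p ∣p∣<n with nonempty? (∁ p)
  ... | yes (x , x∈∁p) = x , x∈∁p⇒x∉p x∈∁p
  ... | no empty       = contradiction (m∸n≡0⇒m≤n n∸∣p∣≡0) (<⇒≱ ∣p∣<n)
    where
    n∸∣p∣≡0 : n ∸ ∣ p ∣ ≡ 0
    n∸∣p∣≡0 = trans (sym (∣∁p∣≡n∸∣p∣ p)) (trans (cong ∣_∣ (Empty-unique empty)) (∣⊥∣≡0 n))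

  ∈-tabulate⁺ : ∀ {f : Fin n → Bool} {x} → f x ≡ true → x ∈ tabulate f
  ∈-tabulate⁺ {f} {x} fx = lookup⇒[]= x (tabulate f) (trans (lookup∘tabulate f x) fx)

  ∈-tabulate⁻ : ∀ {f : Fin n → Bool} {x} → x ∈ tabulate f → f x ≡ true
  ∈-tabulate⁻ {f} {x} x∈ = trans (sym (lookup∘tabulate f x)) ([]=⇒lookup x∈)

  preimage : (Fin n → ℕ) → ℕ → Subset n
  preimage f a = tabulate (λ x → f x ≡ᵇ a)

  ∈-preimage⁺ : ∀ f {x a} → f x ≡ a → x ∈ preimage f a
  ∈-preimage⁺ f {x} {a} fx≡a = ∈-tabulate⁺ (Equivalence.to T-≡ (≡⇒≡ᵇ (f x) a fx≡a))

  ∣preimage∣≤1 : ∀ f → Injective _≡_ _≡_ f → ∀ a → ∣ preimage f a ∣ ≤ 1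
  ∣preimage∣≤1 f f-inj a = ∣p∣≤1 (preimage f a) (λ {x} {y} x∈ y∈ → f-inj (trans (fiber x∈) (sym (fiber y∈))))
    where
    fiber : ∀ {x} → x ∈ preimage f a → f x ≡ a
    fiber {x} x∈ = ≡ᵇ⇒≡ (f x) a (Equivalence.from T-≡ (∈-tabulate⁻ x∈))


unionOver : ∀ {m n} → (Fin m → Subset n) → Subset m → Subset n
unionOver O []            = ∅
unionOver O (inside ∷ X)  = O zero ∪ unionOver (λ f → O (suc f)) X
unionOver O (outside ∷ X) = unionOver (λ f → O (suc f)) X

∣unionOver∣≤ : ∀ {m n c} (O : Fin m → Subset n) → (∀ f → ∣ O f ∣ ≤ c) →
               ∀ X → ∣ unionOver O X ∣ ≤ ∣ X ∣ * c
∣unionOver∣≤ {n = n} O bound []  = ≤-reflexive (∣⊥∣≡0 n)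
∣unionOver∣≤ O bound (inside ∷ X) =
  ≤-trans (∣p∪q∣≤∣p∣+∣q∣ (O zero) _)
          (+-mono-≤ (bound zero) (∣unionOver∣≤ (λ f → O (suc f)) (λ f → bound (suc f)) X))
∣unionOver∣≤ O bound (outside ∷ X) = ∣unionOver∣≤ (λ f → O (suc f)) (λ f → bound (suc f)) X

∈-unionOver : ∀ {m n} (O : Fin m → Subset n) {X f x} → f ∈ X → x ∈ O f → x ∈ unionOver O X
∈-unionOver O {inside ∷ X} {zero}  here       x∈Of = x∈p∪q⁺ (inj₁ x∈Of)
∈-unionOver O {inside ∷ X} {suc f} (there f∈) x∈Of = x∈p∪q⁺ (inj₂ (∈-unionOver (λ f → O (suc f)) f∈ x∈Of))
∈-unionOver O {outside ∷ X} {suc f} (there f∈) x∈Of = ∈-unionOver (λ f → O (suc f)) f∈ x∈Of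

∃-outside-unionOver : ∀ {m n c} (O : Fin m → Subset n) → (∀ f → ∣ O f ∣ ≤ c) →
                      ∀ X → ∣ X ∣ * c < n → ∃ λ x → ∀ {f} → f ∈ X → x ∉ O f
∃-outside-unionOver O bound X small with ∣p∣<n⇒∃∉ (unionOver O X) (≤-<-trans (∣unionOver∣≤ O bound X) small)
... | x , x∉ = x , λ f∈X x∈Of → x∉ (∈-unionOver O f∈X x∈Of)

module _ {B : BiGraph} where

  ∈-edgeSet⁻ : (C : Cycle B) {e : Fin (m B)} → e ∈ edgeSet C → e onCycle C
  ∈-edgeSet⁻ C {e} e∈ = toWitness {a? = any? (λ i → edg C i ≟ᶠ e)} (Equivalence.from T-≡ (∈-tabulate⁻ e∈))

  ∈-E⁻ : (𝒞 : List (Cycle B)) {e : Fin (m B)} → e ∈ E 𝒞 → Any (e onCycle_) 𝒞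
  ∈-E⁻ []      e∈ = contradiction e∈ ∉⊥
  ∈-E⁻ (C ∷ 𝒞) e∈ with x∈p∪q⁻ (edgeSet C) (E 𝒞) e∈
  ... | inj₁ e∈C = hereₗ (∈-edgeSet⁻ C e∈C)
  ... | inj₂ e∈𝒞 = thereₗ (∈-E⁻ 𝒞 e∈𝒞)

  module _ (F : Subset (m B))
           (single : ∀ (C : Cycle B) {i j} → edg C i ∈ F → edg C j ∈ F → i ≡ j)
           (exclusive : ∀ (C D : Cycle B) → EdgeDisjoint C D → ∀ {i j} → edg C i ∈ F → edg D j ∈ F → ⊥) where

    private
      apart : ∀ (C : Cycle B) {𝒞 x y} → All (EdgeDisjoint C) 𝒞 → x ∈ F → y ∈ F →
              x onCycle C → Any (y onCycle_) 𝒞 → ⊥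
      apart C {D ∷ _} (C⊥D ∷ _) x∈F y∈F (i , refl) (hereₗ (j , refl)) = exclusive C D C⊥D x∈F y∈F
      apart C (_ ∷ others) x∈F y∈F x∈C (thereₗ y∈𝒞) = apart C others x∈F y∈F x∈C y∈𝒞

      unique : ∀ (𝒞 : List (Cycle B)) → PairwiseEdgeDisjoint 𝒞 → ∀ {x y} → x ∈ F → y ∈ F →
               Any (x onCycle_) 𝒞 → Any (y onCycle_) 𝒞 → x ≡ y
      unique (C ∷ 𝒞) _ x∈F y∈F (hereₗ (i , refl)) (hereₗ (j , refl)) = cong (edg C) (single C x∈F y∈F)
      unique (C ∷ 𝒞) (C⊥𝒞 ∷ _) x∈F y∈F (hereₗ x∈C)  (thereₗ y∈𝒞) = ⊥-elim (apart C C⊥𝒞 x∈F y∈F x∈C y∈𝒞)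
      unique (C ∷ 𝒞) (C⊥𝒞 ∷ _) x∈F y∈F (thereₗ x∈𝒞) (hereₗ y∈C)  = ⊥-elim (apart C C⊥𝒞 y∈F x∈F y∈C x∈𝒞)
      unique (C ∷ 𝒞) (_ ∷ pairwise) x∈F y∈F (thereₗ x∈𝒞) (thereₗ y∈𝒞) =
        unique 𝒞 pairwise x∈F y∈F x∈𝒞 y∈𝒞

    ∣F∩E∣≤1 : ∀ (𝒞 : List (Cycle B)) → PairwiseEdgeDisjoint 𝒞 → ∣ F ∩ E 𝒞 ∣ ≤ 1
    ∣F∩E∣≤1 𝒞 pairwise = ∣p∣≤1 (F ∩ E 𝒞) λ x∈ y∈ →
      let x∈F , x∈E = x∈p∩q⁻ F (E 𝒞) x∈
          y∈F , y∈E = x∈p∩q⁻ F (E 𝒞) y∈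
      in unique 𝒞 pairwise x∈F y∈F (∈-E⁻ 𝒞 x∈E) (∈-E⁻ 𝒞 y∈E)

module Presented {V E : Set} {nV nE : ℕ} (vertices : Fin nV ↔ V) (edges : Fin nE ↔ E)
                 (tail head : E → V) (loopless : ∀ e → tail e ≢ head e)
                 (tailSign headSign : E → Bool) where

  vertexIndex : V → Fin nV
  vertexIndex = Inverse.from vertices

  vertexIndex-injective : ∀ {u v} → vertexIndex u ≡ vertexIndex v → u ≡ v
  vertexIndex-injective = Injection.injective (↔⇒↣ (↔-sym vertices))

  edgeAt : Fin nE → E
  edgeAt = Inverse.to edges

  edgeIndex : E → Fin nE
  edgeIndex = Inverse.from edges

  edgeAt-edgeIndex : ∀ e → edgeAt (edgeIndex e) ≡ e
  edgeAt-edgeIndex = Inverse.strictlyInverseˡ edges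

  edgeAt-injective : ∀ {f g} → edgeAt f ≡ edgeAt g → f ≡ g
  edgeAt-injective = Injection.injective (↔⇒↣ edges)

  edgeIndex-injective : ∀ {e e′} → edgeIndex e ≡ edgeIndex e′ → e ≡ e′
  edgeIndex-injective = Injection.injective (↔⇒↣ (↔-sym edges))

  graph : BiGraph
  graph = record
    { n      = nV
    ; m      = nE
    ; tl     = λ f → vertexIndex (tail (edgeAt f))
    ; hd     = λ f → vertexIndex (head (edgeAt f))
    ; noLoop = λ f eq → loopless (edgeAt f) (vertexIndex-injective eq)
    ; tlSign = λ f → tailSign (edgeAt f)
    ; hdSign = λ f → headSign (edgeAt f)
    }

  Arc : Set
  Arc = E × Bool

  source target : Arc → V
  source (e , true)  = tail e
  source (e , false) = head e
  target (e , true)  = head e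
  target (e , false) = tail e

  sourceSign targetSign : Arc → Bool
  sourceSign (e , true)  = tailSign e
  sourceSign (e , false) = headSign e
  targetSign (e , true)  = headSign e
  targetSign (e , false) = tailSign e

  reverse : Arc → Arc
  reverse (e , d) = e , not d

  target-reverse : ∀ α → target (reverse α) ≡ source α
  target-reverse (_ , true)  = refl
  target-reverse (_ , false) = refl

  targetSign-reverse : ∀ α → targetSign (reverse α) ≡ sourceSign α
  targetSign-reverse (_ , true)  = refl
  targetSign-reverse (_ , false) = refl

  Links : Arc → Arc → Set
  Links α β = target α ≡ source β × targetSign α ≢ sourceSign β

  Links-reverse : ∀ α β → Links α β → Links (reverse β) (reverse α)
  Links-reverse (_ , true)  (_ , true)  (meet , signs) = sym meet , λ eq → signs (sym eq)
  Links-reverse (_ , true)  (_ , false) (meet , signs) = sym meet , λ eq → signs (sym eq)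
  Links-reverse (_ , false) (_ , true)  (meet , signs) = sym meet , λ eq → signs (sym eq)
  Links-reverse (_ , false) (_ , false) (meet , signs) = sym meet , λ eq → signs (sym eq)

  record Walk (I : Set) : Set where
    field
      step  : I → I
      arc   : I → Arc
      links : ∀ i → Links (arc i) (arc (step i))

  reverseWalk : ∀ {I} (W : Walk I) (back : I → I) → (∀ i → Walk.step W (back i) ≡ i) → Walk I
  reverseWalk W back step∘back = record { step = back ; arc = λ i → reverse (arc (back i)) ; links = links-back }
    where
    open Walk W
    links-back : ∀ i → Links (reverse (arc (back i))) (reverse (arc (back (back i))))
    links-back i = Links-reverse (arc (back (back i))) (arc (back i))
                     (subst (λ j → Links (arc (back (back i))) (arc j)) (step∘back (back i)) (links (back (back i))))

  arcOf : (C : Cycle graph) → Fin (suc (len C)) → Arc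
  arcOf C i = edgeAt (edg C i) , dir C i

  private
    start≡ : ∀ {f e} d → edgeAt f ≡ e → start graph f d ≡ vertexIndex (source (e , d))
    start≡ true  refl = refl
    start≡ false refl = refl

    end≡ : ∀ {f e} d → edgeAt f ≡ e → end graph f d ≡ vertexIndex (target (e , d))
    end≡ true  refl = refl
    end≡ false refl = refl

    startSign≡ : ∀ {f e} d → edgeAt f ≡ e → startSign graph f d ≡ sourceSign (e , d)
    startSign≡ true  refl = refl
    startSign≡ false refl = refl

    endSign≡ : ∀ {f e} d → edgeAt f ≡ e → endSign graph f d ≡ targetSign (e , d)
    endSign≡ true  refl = refl
    endSign≡ false refl = refl

  source-arcOf : (C : Cycle graph) → ∀ i → vertexIndex (source (arcOf C i)) ≡ vtx C i
  source-arcOf C i = trans (sym (start≡ (dir C i) refl)) (startOk C i)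

  source-injective : (C : Cycle graph) → ∀ {i j} → source (arcOf C i) ≡ source (arcOf C j) → i ≡ j
  source-injective C {i} {j} eq = vtxInj C (trans (sym (source-arcOf C i)) (trans (cong vertexIndex eq) (source-arcOf C j)))

  walkOf : (C : Cycle graph) → Walk (Fin (suc (len C)))
  walkOf C = record { step = next ; arc = arcOf C ; links = λ i → meet i , signs i }
    where
    meet : ∀ i → target (arcOf C i) ≡ source (arcOf C (next i))
    meet i = vertexIndex-injective (begin
      vertexIndex (target (arcOf C i))        ≡⟨ sym (end≡ (dir C i) refl) ⟩
      end graph (edg C i) (dir C i)           ≡⟨ endOk C i ⟩
      vtx C (next i)                          ≡⟨ sym (source-arcOf C (next i)) ⟩
      vertexIndex (source (arcOf C (next i))) ∎)
      where open ≡-Reasoning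
    signs : ∀ i → targetSign (arcOf C i) ≢ sourceSign (arcOf C (next i))
    signs i eq = signOk C i (trans (endSign≡ (dir C i) refl) (trans eq (sym (startSign≡ (dir C (next i)) refl))))

  EdgeOf : Cycle graph → E → Set
  EdgeOf C e = ∃ λ i → edgeAt (edg C i) ≡ e

  EdgeDisjoint⇒¬EdgeOf : ∀ C D → EdgeDisjoint C D → ∀ {e} → EdgeOf C e → EdgeOf D e → ⊥
  EdgeDisjoint⇒¬EdgeOf C D C⊥D (i , refl) (j , eq) = C⊥D i j (edgeAt-injective (sym eq))

  record ClosedTrail (L : ℕ) : Set where
    field
      arc                   : ℕ → Arc
      links                 : ∀ t → t < L → Links (arc t) (arc (suc t))
      closes                : Links (arc L) (arc 0)
      vertexPosition        : V → ℕ
      edgePosition          : E → ℕ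
      vertexPosition-source : ∀ t → t ≤ L → vertexPosition (source (arc t)) ≡ t
      edgePosition-arc      : ∀ t → t ≤ L → edgePosition (proj₁ (arc t)) ≡ t

  module _ {L : ℕ} (T : ClosedTrail L) where
    open ClosedTrail T

    private
      arcAt : Fin (suc L) → Arc
      arcAt s = arc (toℕ s)

      links-next : ∀ s → Links (arcAt s) (arcAt (next s))
      links-next s with view s
      ... | ‵fromℕ     = subst₂ Links (cong arc (sym (toℕ-fromℕ L))) (cong arcAt (sym (next-fromℕ L))) closes
      ... | ‵inject₁ j = subst₂ Links (cong arc (sym (toℕ-inject₁ j))) (cong arcAt (sym (next-inject₁ j)))
                                (links (toℕ j) (toℕ<n j))

      position-injective : ∀ {A : Set} (f : Arc → A) (position : A → ℕ) →
                           (∀ t → t ≤ L → position (f (arc t)) ≡ t) →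
                           ∀ {s s′} → f (arcAt s) ≡ f (arcAt s′) → s ≡ s′
      position-injective f position retract {s} {s′} eq = toℕ-injective (begin
        toℕ s                        ≡⟨ sym (retract (toℕ s) (toℕ≤pred[n] s)) ⟩
        position (f (arcAt s))       ≡⟨ cong position eq ⟩
        position (f (arcAt s′))      ≡⟨ retract (toℕ s′) (toℕ≤pred[n] s′) ⟩
        toℕ s′                       ∎)
        where open ≡-Reasoning

    toCycle : Cycle graph
    toCycle = record
      { len     = L
      ; vtx     = λ s → vertexIndex (source (arcAt s))
      ; edg     = λ s → edgeIndex (proj₁ (arcAt s))
      ; dir     = λ s → proj₂ (arcAt s)
      ; vtxInj  = λ eq → position-injective source vertexPosition vertexPosition-source (vertexIndex-injective eq)
      ; edgInj  = λ eq → position-injective proj₁ edgePosition edgePosition-arc (edgeIndex-injective eq)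
      ; startOk = λ s → start≡ (proj₂ (arcAt s)) (edgeAt-edgeIndex _)
      ; endOk   = λ s → trans (end≡ (proj₂ (arcAt s)) (edgeAt-edgeIndex _)) (cong vertexIndex (proj₁ (links-next s)))
      ; signOk  = λ s eq → proj₂ (links-next s)
          (trans (sym (endSign≡ (proj₂ (arcAt s)) (edgeAt-edgeIndex _)))
                 (trans eq (startSign≡ (proj₂ (arcAt (next s))) (edgeAt-edgeIndex _))))
      }

    arcOf-toCycle : ∀ s → arcOf toCycle s ≡ arc (toℕ s)
    arcOf-toCycle s = cong (_, proj₂ (arc (toℕ s))) (edgeAt-edgeIndex (proj₁ (arc (toℕ s))))

module Construction (k : ℕ) where

  M H W : ℕ
  M = suc (k * 2)
  H = double M
  W = H + H

  Column Level : Set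
  Column = Fin (suc W)
  Level  = Fin (suc H)

  Vertex : Set
  Vertex = ⊤ ⊎ (Column × Level) ⊎ (Column × Level)

  pattern hub      = inj₁ tt
  pattern vin  x y = inj₂ (inj₁ (x , y))
  pattern vout x y = inj₂ (inj₂ (x , y))

  Edge : Set
  Edge = (Column × Level) ⊎ (Column × Fin H) ⊎ (Fin W × Fin H) ⊎ Fin M ⊎ Column

  pattern spine    x y = inj₁ (x , y)
  pattern vertical x j = inj₂ (inj₁ (x , j))
  pattern diagonal x j = inj₂ (inj₂ (inj₁ (x , j)))
  pattern fedge    i   = inj₂ (inj₂ (inj₂ (inj₁ i)))
  pattern hubEdge  x   = inj₂ (inj₂ (inj₂ (inj₂ x)))

  vertices : Fin (1 + (suc W * suc H + suc W * suc H)) ↔ Vertex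
  vertices = ↔-trans +↔⊎ (1↔⊤ ⊎-↔ ↔-trans +↔⊎ (*↔× ⊎-↔ *↔×))

  edges : Fin (suc W * suc H + (suc W * H + (W * H + (M + suc W)))) ↔ Edge
  edges = ↔-trans +↔⊎ (*↔× ⊎-↔ ↔-trans +↔⊎ (*↔× ⊎-↔ ↔-trans +↔⊎ (*↔× ⊎-↔ +↔⊎)))

  top : Level
  top = fromℕ H

  left right : Fin M → Column
  left  i = clamp (double (toℕ i))
  right i = clamp (suc (double (toℕ i)))

  isLeft : Column → Bool
  isLeft x = does (toℕ x <? H)

  tail head : Edge → Vertex
  tail (spine x y)    = vin x y
  tail (vertical x j) = vout x (inject₁ j)
  tail (diagonal x j) = vout (suc x) (inject₁ j)
  tail (fedge i)      = vout (left i) top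
  tail (hubEdge x)    = vin x zero
  head (spine x y)    = vout x y
  head (vertical x j) = vin x (suc j)
  head (diagonal x j) = vin (inject₁ x) (suc j)
  head (fedge i)      = vout (right i) top
  head (hubEdge x)    = hub

  tailSign headSign : Edge → Bool
  tailSign (hubEdge _) = false
  tailSign _           = true
  headSign (fedge _)   = true
  headSign (hubEdge x) = isLeft x
  headSign _           = false

  toℕ-left : ∀ i → toℕ (left i) ≡ double (toℕ i)
  toℕ-left i = toℕ-clamp (≤-trans (n≤1+n _) (<⇒≤ (≤-trans (double-< (toℕ<n i)) (m≤m+n H H))))

  toℕ-right : ∀ i → toℕ (right i) ≡ suc (double (toℕ i))
  toℕ-right i = toℕ-clamp (<⇒≤ (≤-trans (double-< (toℕ<n i)) (m≤m+n H H)))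

  loopless : ∀ e → tail e ≢ head e
  loopless (fedge i) eq = 1+n≢n (sym (begin
    double (toℕ i)      ≡⟨ sym (toℕ-left i) ⟩
    toℕ (left i)        ≡⟨ cong outColumn eq ⟩
    toℕ (right i)       ≡⟨ toℕ-right i ⟩
    suc (double (toℕ i)) ∎))
    where
    open ≡-Reasoning
    outColumn : Vertex → ℕ
    outColumn (vout x _) = toℕ x
    outColumn _          = 0
  loopless (spine _ _)    ()
  loopless (vertical _ _) ()
  loopless (diagonal _ _) ()
  loopless (hubEdge _)    ()

  open Presented vertices edges tail head loopless tailSign headSign public

  leave⁻-vout : ∀ α {x y} → sourceSign α ≡ false → source α ≡ vout x y → α ≡ (spine x y , false)
  leave⁻-vout (spine _ _    , false) _  refl = refl
  leave⁻-vout (spine _ _    , true)  () _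
  leave⁻-vout (vertical _ _ , true)  () _
  leave⁻-vout (vertical _ _ , false) _  ()
  leave⁻-vout (diagonal _ _ , true)  () _
  leave⁻-vout (diagonal _ _ , false) _  ()
  leave⁻-vout (fedge _      , true)  () _
  leave⁻-vout (fedge _      , false) () _
  leave⁻-vout (hubEdge _    , true)  _  ()
  leave⁻-vout (hubEdge _    , false) _  ()

  leave⁻-vin-suc : ∀ α {x j} → sourceSign α ≡ false → source α ≡ vin x (suc j) →
                   α ≡ (vertical x j , false) ⊎ ∃ λ x′ → inject₁ x′ ≡ x × α ≡ (diagonal x′ j , false)
  leave⁻-vin-suc (vertical _ _ , false) _  refl = inj₁ refl
  leave⁻-vin-suc (diagonal x′ _ , false) _ refl = inj₂ (x′ , refl , refl)
  leave⁻-vin-suc (spine _ _    , true)  () _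
  leave⁻-vin-suc (spine _ _    , false) _  ()
  leave⁻-vin-suc (vertical _ _ , true)  () _
  leave⁻-vin-suc (diagonal _ _ , true)  () _
  leave⁻-vin-suc (fedge _      , true)  () _
  leave⁻-vin-suc (fedge _      , false) () _
  leave⁻-vin-suc (hubEdge _    , true)  _  ()
  leave⁻-vin-suc (hubEdge _    , false) _  ()

  leave⁻-vin-zero : ∀ α {x} → sourceSign α ≡ false → source α ≡ vin x zero → α ≡ (hubEdge x , true)
  leave⁻-vin-zero (hubEdge _    , true)  _  refl = refl
  leave⁻-vin-zero (spine _ _    , true)  () _
  leave⁻-vin-zero (spine _ _    , false) _  ()
  leave⁻-vin-zero (vertical _ _ , true)  () _
  leave⁻-vin-zero (vertical _ _ , false) _  ()
  leave⁻-vin-zero (diagonal _ _ , true)  () _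
  leave⁻-vin-zero (diagonal _ _ , false) _  ()
  leave⁻-vin-zero (fedge _      , true)  () _
  leave⁻-vin-zero (fedge _      , false) () _
  leave⁻-vin-zero (hubEdge _    , false) _  ()

  data Descent (P : Edge → Set) : Level → Column → Set where
    base : ∀ {x} → P (spine x zero) → Descent P zero x
    down : ∀ {j x x′} → P (spine x (suc j)) → toℕ x ≤ toℕ x′ → toℕ x′ ≤ suc (toℕ x) →
           Descent P (inject₁ j) x′ → Descent P (suc j) x

  bottom : ∀ {P y x} → Descent P y x → Column
  bottom (base {x} _)   = x
  bottom (down _ _ _ D) = bottom D

  module _ {I : Set} (W : Walk I) (P : Edge → Set) (onP : ∀ i → P (proj₁ (Walk.arc W i))) where
    open Walk W

    private
      leaves⁻ : ∀ i → targetSign (arc i) ≡ true → sourceSign (arc (step i)) ≡ false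
      leaves⁻ i positive = not-injective (trans (sym (¬-not (proj₂ (links i)))) positive)

      spineDown : ∀ {c x y} → target (arc c) ≡ vout x y → targetSign (arc c) ≡ true →
                  arc (step c) ≡ (spine x y , false)
      spineDown {c} arrive positive = leave⁻-vout (arc (step c)) (leaves⁻ c positive) (trans (sym (proj₁ (links c))) arrive)

      leavesSpine : ∀ {c x y} → arc c ≡ (spine x y , false) →
                    sourceSign (arc (step c)) ≡ false × source (arc (step c)) ≡ vin x y
      leavesSpine {c} eq = leaves⁻ c (cong targetSign eq) , trans (sym (proj₁ (links c))) (cong target eq)

    descend : ∀ l {c x} {y : Level} → toℕ y ≡ l → target (arc c) ≡ vout x y → targetSign (arc c) ≡ true →
              Σ (Descent P y x) λ D → arc (iterate step c (double (suc l))) ≡ (hubEdge (bottom D) , true)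
    descend zero    {y = suc _} () _ _
    descend (suc l) {y = zero}  () _ _
    descend zero {c} {x} {zero} _ arrive positive =
      base (subst P (cong proj₁ spine₁) (onP (step c))) ,
      leave⁻-vin-zero (arc (step (step c))) (proj₁ (leavesSpine spine₁)) (proj₂ (leavesSpine spine₁))
      where
      spine₁ = spineDown arrive positive
    descend (suc l) {c} {x} {suc j} level arrive positive =
      nextLevel (leave⁻-vin-suc (arc (step (step c))) (proj₁ (leavesSpine spine₁)) (proj₂ (leavesSpine spine₁)))
      where
      spine₁ = spineDown arrive positive
      onSpine : P (spine x (suc j))
      onSpine = subst P (cong proj₁ spine₁) (onP (step c))
      level′ : toℕ (inject₁ j) ≡ l
      level′ = trans (toℕ-inject₁ j) (suc-injective level)
      nextLevel : arc (step (step c)) ≡ (vertical x j , false) ⊎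
              (∃ λ x′ → inject₁ x′ ≡ x × arc (step (step c)) ≡ (diagonal x′ j , false)) →
              Σ (Descent P (suc j) x) λ D → arc (iterate step c (double (suc (suc l)))) ≡ (hubEdge (bottom D) , true)
      nextLevel (inj₁ vertical₂) with descend l level′ (cong target vertical₂) (cong targetSign vertical₂)
      ... | D , arrival = down onSpine ≤-refl (n≤1+n _) D , arrival
      nextLevel (inj₂ (x′ , x′≡x , diagonal₂)) with descend l level′ (cong target diagonal₂) (cong targetSign diagonal₂)
      ... | D , arrival = down onSpine (≤-trans (≤-reflexive x≡x′) (n≤1+n _)) (s≤s (≤-reflexive (sym x≡x′))) D , arrival
        where
        x≡x′ : toℕ x ≡ toℕ x′
        x≡x′ = trans (cong toℕ (sym x′≡x)) (toℕ-inject₁ x′)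

  hubDistance : ℕ
  hubDistance = double (suc H)

  Near : Fin M → Column → Set
  Near j x = double (toℕ j) ≤ toℕ x × toℕ x ≤ suc (double (toℕ j))

  fedge-target : ∀ α {j} → proj₁ α ≡ fedge j →
                 Σ Column λ x → Near j x × target α ≡ vout x top × targetSign α ≡ true
  fedge-target (_ , true)  {j} refl = right j , near-right , refl , refl
    where
    near-right : Near j (right j)
    near-right = ≤-trans (n≤1+n _) (≤-reflexive (sym (toℕ-right j))) , ≤-reflexive (toℕ-right j)
  fedge-target (_ , false) {j} refl = left j , near-left , refl , refl
    where
    near-left : Near j (left j)
    near-left = ≤-reflexive (sym (toℕ-left j)) , ≤-trans (≤-reflexive (toℕ-left j)) (n≤1+n _)

  module _ {I : Set} (W : Walk I) (P : Edge → Set) (onP : ∀ i → P (proj₁ (Walk.arc W i))) where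
    open Walk W

    DescentToHub : I → Fin M → Set
    DescentToHub a j = Σ Column λ x → Near j x × Σ (Descent P top x) λ D →
                         arc (iterate step a hubDistance) ≡ (hubEdge (bottom D) , true)

    descendFrom : ∀ {a j} → proj₁ (arc a) ≡ fedge j → DescentToHub a j
    descendFrom {a} {j} isF = go (fedge-target (arc a) isF)
      where
      go : (Σ Column λ x → Near j x × target (arc a) ≡ vout x top × targetSign (arc a) ≡ true) → DescentToHub a j
      go (x , near , arrive , positive) = x , near , descend W P onP H (toℕ-fromℕ H) arrive positive

  ordered : ∀ {P Q : Edge → Set} → (∀ {e} → P e → Q e → ⊥) →
            ∀ {y x x′} (p : Descent P y x) (q : Descent Q y x′) → toℕ (bottom q) < toℕ (bottom p) → toℕ x′ < toℕ x
  ordered apart (base _) (base _) below = below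
  ordered {Q = Q} apart (down onP _ ≤sx p) (down onQ x′≤ _ q) below =
    ≤∧≢⇒< (s≤s⁻¹ (≤-trans (s≤s x′≤) (≤-trans (ordered apart p q below) ≤sx)))
          (λ same → apart onP (subst (λ z → Q (spine z _)) (toℕ-injective same) onQ))

  record Legs (P : Edge → Set) (j : Fin M) : Set where
    field
      {leftTop rightTop} : Column
      leftLeg        : Descent P top leftTop
      rightLeg       : Descent P top rightTop
      leftLeg-lands  : toℕ (bottom leftLeg) < H
      rightLeg-lands : H ≤ toℕ (bottom rightLeg)
      leftTop-near   : Near j leftTop
      rightTop-near  : Near j rightTop

  legs-ordered : ∀ {P Q j j′} → (∀ {e} → P e → Q e → ⊥) → Legs P j → Legs Q j′ → toℕ j′ ≤ toℕ j
  legs-ordered apart T U = double-cancel-≤ (≤-trans (proj₁ (leftTop-near U))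
                                           (≤-trans (<⇒≤ crossing) (proj₂ (rightTop-near T))))
    where
    open Legs
    crossing = ordered apart (rightLeg T) (leftLeg U) (<-≤-trans (leftLeg-lands U) (rightLeg-lands T))

  sides : ∀ {u v} → isLeft u ≢ isLeft v → (toℕ u < H × H ≤ toℕ v) ⊎ (toℕ v < H × H ≤ toℕ u)
  sides {u} {v} differ with toℕ u <? H | toℕ v <? H
  ... | yes u<H | yes v<H = ⊥-elim (differ (trans (dec-true (toℕ u <? H) u<H) (sym (dec-true (toℕ v <? H) v<H))))
  ... | yes u<H | no  v≮H = inj₁ (u<H , ≮⇒≥ v≮H)
  ... | no  u≮H | yes v<H = inj₂ (v<H , ≮⇒≥ u≮H)
  ... | no  u≮H | no  v≮H = ⊥-elim (differ (trans (dec-false (toℕ u <? H) u≮H) (sym (dec-false (toℕ v <? H) v≮H))))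

  legs-from : ∀ {P j x₁ x₂} (D₁ : Descent P top x₁) (D₂ : Descent P top x₂) → Near j x₁ → Near j x₂ →
              isLeft (bottom D₁) ≢ isLeft (bottom D₂) → Legs P j
  legs-from D₁ D₂ near₁ near₂ differ with sides differ
  ... | inj₁ (lands₁ , lands₂) = record
    { leftLeg = D₁ ; rightLeg = D₂ ; leftLeg-lands = lands₁ ; rightLeg-lands = lands₂
    ; leftTop-near = near₁ ; rightTop-near = near₂ }
  ... | inj₂ (lands₂ , lands₁) = record
    { leftLeg = D₂ ; rightLeg = D₁ ; leftLeg-lands = lands₂ ; rightLeg-lands = lands₁
    ; leftTop-near = near₂ ; rightTop-near = near₁ }

  module _ (C : Cycle graph) where
    open Walk (walkOf C)

    private
      forward backward : Walk (Fin (suc (len C)))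
      forward  = walkOf C
      backward = reverseWalk forward prev next-prev

      onForward : ∀ i → EdgeOf C (proj₁ (Walk.arc forward i))
      onForward i = i , refl

      onBackward : ∀ i → EdgeOf C (proj₁ (Walk.arc backward i))
      onBackward i = prev i , refl

    hub-after : ∀ {b h} → arcOf C b ≡ (hubEdge h , true) → source (arcOf C (next b)) ≡ hub
    hub-after {b} arrival = trans (sym (proj₁ (links b))) (cong target arrival)

    hub-sides : ∀ {b₁ b₂ h₁ h₂} → arcOf C b₁ ≡ (hubEdge h₁ , true) →
                reverse (arcOf C b₂) ≡ (hubEdge h₂ , true) → isLeft h₁ ≢ isLeft h₂
    hub-sides {b₁} {b₂} {h₁} {h₂} arrival₁ arrival₂ eq = proj₂ (links b₁) (begin
      targetSign (arcOf C b₁)             ≡⟨ cong targetSign arrival₁ ⟩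
      isLeft h₁                           ≡⟨ eq ⟩
      isLeft h₂                           ≡⟨ cong targetSign (sym arrival₂) ⟩
      targetSign (reverse (arcOf C b₂))   ≡⟨ targetSign-reverse (arcOf C b₂) ⟩
      sourceSign (arcOf C b₂)             ≡⟨ cong (λ b → sourceSign (arcOf C b)) (sym same) ⟩
      sourceSign (arcOf C (next b₁))      ∎)
      where
      open ≡-Reasoning
      same : next b₁ ≡ b₂
      same = source-injective C (trans (hub-after arrival₁)
                                       (sym (trans (sym (target-reverse (arcOf C b₂))) (cong target arrival₂))))

    legs : ∀ {a j} → edgeAt (edg C a) ≡ fedge j → Legs (EdgeOf C) j
    legs {a} {j} isF = assemble (descendFrom forward (EdgeOf C) onForward {a = a} isF)
                                (descendFrom backward (EdgeOf C) onBackward {a = next a}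
                                   (trans (cong (λ i → edgeAt (edg C i)) (prev-next a)) isF))
      where
      assemble : DescentToHub forward (EdgeOf C) onForward a j →
                 DescentToHub backward (EdgeOf C) onBackward (next a) j → Legs (EdgeOf C) j
      assemble (_ , near₁ , D₁ , arrival₁) (_ , near₂ , D₂ , arrival₂) =
        legs-from D₁ D₂ near₁ near₂
          (hub-sides {b₁ = iterate next a hubDistance} {b₂ = prev (iterate prev (next a) hubDistance)} arrival₁ arrival₂)

    F-edge-unique : ∀ {a a′ j j′} → edgeAt (edg C a) ≡ fedge j → edgeAt (edg C a′) ≡ fedge j′ → a ≡ a′
    F-edge-unique {a} {a′} {j} {j′} isF isF′ = compare (descendFrom forward (EdgeOf C) onForward {a = a} isF)
                                                        (descendFrom forward (EdgeOf C) onForward {a = a′} isF′)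
      where
      compare : DescentToHub forward (EdgeOf C) onForward a j → DescentToHub forward (EdgeOf C) onForward a′ j′ → a ≡ a′
      compare (_ , _ , _ , arrival) (_ , _ , _ , arrival′) =
        iterate-injective next-injective hubDistance (next-injective (source-injective C
          (trans (hub-after {b = iterate next a hubDistance} arrival) (sym (hub-after {b = iterate next a′ hubDistance} arrival′)))))

  F-edges-exclusive : ∀ (C D : Cycle graph) → EdgeDisjoint C D → ∀ {a b j j′} →
                      edgeAt (edg C a) ≡ fedge j → edgeAt (edg D b) ≡ fedge j′ → ⊥
  F-edges-exclusive C D C⊥D {a} {b} {j} {j′} isF isF′ = apart (a , isF) (b , trans isF′ (cong fedge (sym j≡j′)))
    where
    apart : ∀ {e} → EdgeOf C e → EdgeOf D e → ⊥
    apart = EdgeDisjoint⇒¬EdgeOf C D C⊥D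
    j≡j′ : j ≡ j′
    j≡j′ = toℕ-injective (≤-antisym (legs-ordered (λ q p → apart p q) (legs D isF′) (legs C isF))
                                    (legs-ordered apart (legs C isF) (legs D isF′)))

  -- Positions on the cycle through F-edge i, in order: out of the hub, up column 2i, across F-edge i, and down
  -- the diagonal, whose u-th spine edge is at level H - u of column 2i + 1 + u.
  data Slot : Set where
    hubOut fEdge hubIn                : Slot
    upSpine upStep downSpine downStep : ℕ → Slot

  nextSlot : Slot → Slot
  nextSlot hubOut = upSpine 0
  nextSlot (upSpine y) with y <? H
  ... | yes _ = upStep y
  ... | no  _ = fEdge
  nextSlot (upStep y) = upSpine (suc y)
  nextSlot fEdge = downSpine 0
  nextSlot (downSpine u) with u <? H
  ... | yes _ = downStep u
  ... | no  _ = hubIn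
  nextSlot (downStep u) = downSpine (suc u)
  nextSlot hubIn = hubOut

  Valid : Slot → Set
  Valid (upSpine y)   = y ≤ H
  Valid (upStep y)    = y < H
  Valid (downSpine u) = u ≤ H
  Valid (downStep u)  = u < H
  Valid _             = ⊤

  position : Slot → ℕ
  position hubOut        = 0
  position (upSpine y)   = 1 + double y
  position (upStep y)    = 2 + double y
  position fEdge         = 2 + double H
  position (downSpine u) = 3 + double (u + H)
  position (downStep u)  = 4 + double (u + H)
  position hubIn         = 4 + double (H + H)

  nextSlot-upSpine-< : ∀ {y} → y < H → nextSlot (upSpine y) ≡ upStep y
  nextSlot-upSpine-< {y} y<H with y <? H
  ... | yes _   = refl
  ... | no  y≮H = contradiction y<H y≮H

  nextSlot-upSpine-H : nextSlot (upSpine H) ≡ fEdge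
  nextSlot-upSpine-H with H <? H
  ... | yes H<H = contradiction H<H (n≮n H)
  ... | no  _   = refl

  nextSlot-downSpine-< : ∀ {u} → u < H → nextSlot (downSpine u) ≡ downStep u
  nextSlot-downSpine-< {u} u<H with u <? H
  ... | yes _   = refl
  ... | no  u≮H = contradiction u<H u≮H

  nextSlot-downSpine-H : nextSlot (downSpine H) ≡ hubIn
  nextSlot-downSpine-H with H <? H
  ... | yes H<H = contradiction H<H (n≮n H)
  ... | no  _   = refl

  position-nextSlot : ∀ s → Valid s → s ≢ hubIn → Valid (nextSlot s) × position (nextSlot s) ≡ suc (position s)
  position-nextSlot hubOut        _   _ = z≤n , refl
  position-nextSlot (upSpine y)   y≤H _ with m≤n⇒m<n∨m≡n y≤H
  ... | inj₁ y<H  rewrite nextSlot-upSpine-< y<H = y<H , refl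
  ... | inj₂ refl rewrite nextSlot-upSpine-H     = tt , refl
  position-nextSlot (upStep y)    y<H _ = y<H , refl
  position-nextSlot fEdge         _   _ = z≤n , refl
  position-nextSlot (downSpine u) u≤H _ with m≤n⇒m<n∨m≡n u≤H
  ... | inj₁ u<H  rewrite nextSlot-downSpine-< u<H = u<H , refl
  ... | inj₂ refl rewrite nextSlot-downSpine-H     = tt , refl
  position-nextSlot (downStep u)  u<H _ = u<H , refl
  position-nextSlot hubIn         _   hubIn≢hubIn = contradiction refl hubIn≢hubIn

  slot : ℕ → Slot
  slot = fold hubOut nextSlot

  slot-valid : ∀ t → t ≤ position hubIn → Valid (slot t) × position (slot t) ≡ t
  slot-valid zero    _    = tt , refl
  slot-valid (suc t) t<L with slot-valid t (<⇒≤ t<L)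
  ... | valid , at-t with position-nextSlot (slot t) valid (λ eq → <⇒≢ t<L (trans (sym at-t) (cong position eq)))
  ... | valid′ , step = valid′ , trans step (cong suc at-t)

  slot-upSpine : ∀ y → y ≤ H → slot (1 + double y) ≡ upSpine y
  slot-upSpine zero    _     = refl
  slot-upSpine (suc y) sy≤H = trans (cong (λ s → nextSlot (nextSlot s)) (slot-upSpine y (<⇒≤ sy≤H)))
                                    (cong nextSlot (nextSlot-upSpine-< sy≤H))

  slot-fEdge : slot (2 + double H) ≡ fEdge
  slot-fEdge = trans (cong nextSlot (slot-upSpine H ≤-refl)) nextSlot-upSpine-H

  slot-downSpine : ∀ u → u ≤ H → slot (3 + double (u + H)) ≡ downSpine u
  slot-downSpine zero    _    = cong nextSlot slot-fEdge
  slot-downSpine (suc u) su≤H = trans (cong (λ s → nextSlot (nextSlot s)) (slot-downSpine u (<⇒≤ su≤H)))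
                                      (cong nextSlot (nextSlot-downSpine-< su≤H))

  slot-hubIn : slot (position hubIn) ≡ hubIn
  slot-hubIn = trans (cong nextSlot (slot-downSpine H ≤-refl)) nextSlot-downSpine-H

  -- The column of the ascending part and the column + level of the descending part of the cycle through F-edge j.
  leftKey rightKey : Fin M → ℕ
  leftKey  j = double (toℕ j)
  rightKey j = H + suc (double (toℕ j))

  leftOwners rightOwners : ℕ → Subset M
  leftOwners  = preimage leftKey
  rightOwners = preimage rightKey

  ∣leftOwners∣≤1 : ∀ a → ∣ leftOwners a ∣ ≤ 1
  ∣leftOwners∣≤1 = ∣preimage∣≤1 leftKey (λ eq → toℕ-injective (double-injective eq))

  ∣rightOwners∣≤1 : ∀ a → ∣ rightOwners a ∣ ≤ 1
  ∣rightOwners∣≤1 =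
    ∣preimage∣≤1 rightKey (λ eq → toℕ-injective (double-injective (suc-injective (+-cancelˡ-≡ H _ _ eq))))

  owners : Edge → Subset M
  owners (spine x y)    = leftOwners (toℕ x) ∪ rightOwners (toℕ x + toℕ y)
  owners (vertical x _) = leftOwners (toℕ x)
  owners (diagonal x j) = rightOwners (toℕ x + suc (toℕ j))
  owners (fedge j)      = ⁅ j ⁆
  owners (hubEdge x)    = leftOwners (toℕ x) ∪ rightOwners (toℕ x)

  ∣owners∣≤2 : ∀ e → ∣ owners e ∣ ≤ 2
  ∣owners∣≤2 (spine x y)    = ≤-trans (∣p∪q∣≤∣p∣+∣q∣ (leftOwners (toℕ x)) (rightOwners (toℕ x + toℕ y)))
                                      (+-mono-≤ (∣leftOwners∣≤1 (toℕ x)) (∣rightOwners∣≤1 (toℕ x + toℕ y)))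
  ∣owners∣≤2 (vertical x _) = ≤-trans (∣leftOwners∣≤1 (toℕ x)) (n≤1+n 1)
  ∣owners∣≤2 (diagonal x j) = ≤-trans (∣rightOwners∣≤1 (toℕ x + suc (toℕ j))) (n≤1+n 1)
  ∣owners∣≤2 (fedge j)      = ≤-trans (≤-reflexive (∣⁅x⁆∣≡1 j)) (n≤1+n 1)
  ∣owners∣≤2 (hubEdge x)    = ≤-trans (∣p∪q∣≤∣p∣+∣q∣ (leftOwners (toℕ x)) (rightOwners (toℕ x)))
                                      (+-mono-≤ (∣leftOwners∣≤1 (toℕ x)) (∣rightOwners∣≤1 (toℕ x)))

  module CycleThrough (i : Fin M) where

    col : ℕ
    col = double (toℕ i)

    col<H : suc col < H
    col<H = double-< (toℕ<n i)

    downColumn : ℕ → Column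
    downColumn u = clamp (u + suc col)

    diagColumn : ℕ → Fin W
    diagColumn u = clamp (u + suc col)

    downLevel : ℕ → Level
    downLevel u = clamp (H ∸ u)

    diagLevel : ℕ → Fin H
    diagLevel u = clamp (H ∸ suc u)

    arcAt : Slot → Arc
    arcAt hubOut        = hubEdge (left i) , false
    arcAt (upSpine y)   = spine (left i) (clamp y) , true
    arcAt (upStep y)    = vertical (left i) (clamp y) , true
    arcAt fEdge         = fedge i , true
    arcAt (downSpine u) = spine (downColumn u) (downLevel u) , false
    arcAt (downStep u)  = diagonal (diagColumn u) (diagLevel u) , false
    arcAt hubIn         = hubEdge (downColumn H) , true

    downColumn-bound : ∀ {u} → u ≤ H → u + suc col ≤ W
    downColumn-bound u≤H = +-mono-≤ u≤H (<⇒≤ col<H)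

    inject₁-diagColumn : ∀ {u} → u < H → inject₁ (diagColumn u) ≡ downColumn u
    inject₁-diagColumn u<H = inject₁-clamp (<⇒≤pred (downColumn-bound u<H))

    H∸u≡1+H∸1+u : ∀ {u} → u < H → H ∸ u ≡ suc (H ∸ suc u)
    H∸u≡1+H∸1+u u<H = +-∸-assoc 1 u<H

    suc-diagLevel : ∀ {u} → u < H → suc (diagLevel u) ≡ downLevel u
    suc-diagLevel u<H = cong clamp (sym (H∸u≡1+H∸1+u u<H))

    inject₁-diagLevel : ∀ u → inject₁ (diagLevel u) ≡ downLevel (suc u)
    inject₁-diagLevel u = inject₁-clamp (m∸n≤m _ u)

    isLeft-left : isLeft (left i) ≡ true
    isLeft-left = dec-true (toℕ (left i) <? H) (subst (_< H) (sym (toℕ-left i)) (<-trans (n<1+n col) col<H))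

    toℕ-downColumn : ∀ {u} → u ≤ H → toℕ (downColumn u) ≡ u + suc col
    toℕ-downColumn u≤H = toℕ-clamp (downColumn-bound u≤H)

    isLeft-downColumn-H : isLeft (downColumn H) ≡ false
    isLeft-downColumn-H = dec-false (toℕ (downColumn H) <? H)
                            (≤⇒≯ (subst (H ≤_) (sym (toℕ-downColumn ≤-refl)) (m≤m+n H (suc col))))

    links-nextSlot : ∀ s → Valid s → Links (arcAt s) (arcAt (nextSlot s))
    links-nextSlot hubOut _ = refl , λ ()
    links-nextSlot (upSpine y) y≤H with m≤n⇒m<n∨m≡n y≤H
    ... | inj₁ y<H  rewrite nextSlot-upSpine-< y<H = cong (vout (left i)) (sym (inject₁-clamp (<⇒≤pred y<H))) , λ ()
    ... | inj₂ refl rewrite nextSlot-upSpine-H     = cong (vout (left i)) (clamp-top H) , λ ()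
    links-nextSlot (upStep y) _ = refl , λ ()
    links-nextSlot fEdge _ = cong (vout (right i)) (sym (clamp-top H)) , λ ()
    links-nextSlot (downSpine u) u≤H with m≤n⇒m<n∨m≡n u≤H
    ... | inj₁ u<H  rewrite nextSlot-downSpine-< u<H =
          cong₂ vin (sym (inject₁-diagColumn u<H)) (sym (suc-diagLevel u<H)) , λ ()
    ... | inj₂ refl rewrite nextSlot-downSpine-H =
          cong (vin (downColumn H)) (cong clamp (n∸n≡0 H)) , λ ()
    links-nextSlot (downStep u) _ = cong (vout (downColumn (suc u))) (inject₁-diagLevel u) , λ ()
    links-nextSlot hubIn _ = refl , λ eq → contradiction (trans (sym isLeft-downColumn-H) (trans eq isLeft-left)) λ ()

    onLeft : Column → Bool
    onLeft x = does (toℕ x ≟ col)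

    onLeft-left : onLeft (left i) ≡ true
    onLeft-left = dec-true (toℕ (left i) ≟ col) (toℕ-left i)

    onLeft-downColumn : ∀ {u} → u ≤ H → onLeft (downColumn u) ≡ false
    onLeft-downColumn {u} u≤H = dec-false (toℕ (downColumn u) ≟ col) λ eq →
      <-irrefl (sym eq) (≤-trans (s≤s (m≤n+m col u)) (≤-reflexive (trans (sym (+-suc u col)) (sym (toℕ-downColumn u≤H)))))

    H∸downLevel : ∀ {u} → u ≤ H → H ∸ toℕ (downLevel u) ≡ u
    H∸downLevel {u} u≤H = trans (cong (H ∸_) (toℕ-clamp (m∸n≤m H u))) (m∸[m∸n]≡n u≤H)

    H∸suc-diagLevel : ∀ {u} → u < H → H ∸ suc (toℕ (diagLevel u)) ≡ u
    H∸suc-diagLevel {u} u<H = trans (cong (λ y → H ∸ toℕ y) (suc-diagLevel u<H)) (H∸downLevel (<⇒≤ u<H))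

    vertexPosition : Vertex → ℕ
    vertexPosition hub        = 0
    vertexPosition (vin x y)  = if onLeft x then 1 + double (toℕ y) else 4 + double ((H ∸ toℕ y) + H)
    vertexPosition (vout x y) = if onLeft x then 2 + double (toℕ y) else 3 + double ((H ∸ toℕ y) + H)

    edgePosition : Edge → ℕ
    edgePosition (spine x y)    = if onLeft x then 1 + double (toℕ y) else 3 + double ((H ∸ toℕ y) + H)
    edgePosition (vertical _ j) = 2 + double (toℕ j)
    edgePosition (diagonal _ j) = 4 + double ((H ∸ suc (toℕ j)) + H)
    edgePosition (fedge _)      = 2 + double H
    edgePosition (hubEdge x)    = if onLeft x then 0 else 4 + double (H + H)

    vertexPosition-vin-down : ∀ {u} → u ≤ H → vertexPosition (vin (downColumn u) (downLevel u)) ≡ 4 + double (u + H)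
    vertexPosition-vin-down u≤H rewrite onLeft-downColumn u≤H = cong (λ n → 4 + double (n + H)) (H∸downLevel u≤H)

    vertexPosition-source : ∀ s → Valid s → vertexPosition (source (arcAt s)) ≡ position s
    vertexPosition-source hubOut        _   = refl
    vertexPosition-source (upSpine y)   y≤H rewrite onLeft-left = cong (λ n → 1 + double n) (toℕ-clamp y≤H)
    vertexPosition-source (upStep y)    y<H rewrite onLeft-left =
      cong (λ n → 2 + double n) (trans (toℕ-inject₁ (clamp y)) (toℕ-clamp (<⇒≤pred y<H)))
    vertexPosition-source fEdge         _   rewrite onLeft-left = cong (λ n → 2 + double n) (toℕ-fromℕ H)
    vertexPosition-source (downSpine u) u≤H rewrite onLeft-downColumn u≤H = cong (λ n → 3 + double (n + H)) (H∸downLevel u≤H)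
    vertexPosition-source (downStep u)  u<H =
      trans (cong₂ (λ x y → vertexPosition (vin x y)) (inject₁-diagColumn u<H) (suc-diagLevel u<H))
            (vertexPosition-vin-down (<⇒≤ u<H))
    vertexPosition-source hubIn         _   rewrite onLeft-downColumn {H} ≤-refl = refl

    edgePosition-arc : ∀ s → Valid s → edgePosition (proj₁ (arcAt s)) ≡ position s
    edgePosition-arc hubOut        _   rewrite onLeft-left = refl
    edgePosition-arc (upSpine y)   y≤H rewrite onLeft-left = cong (λ n → 1 + double n) (toℕ-clamp y≤H)
    edgePosition-arc (upStep y)    y<H = cong (λ n → 2 + double n) (toℕ-clamp (<⇒≤pred y<H))
    edgePosition-arc fEdge         _   = refl
    edgePosition-arc (downSpine u) u≤H rewrite onLeft-downColumn u≤H = cong (λ n → 3 + double (n + H)) (H∸downLevel u≤H)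
    edgePosition-arc (downStep u)  u<H = cong (λ n → 4 + double (n + H)) (H∸suc-diagLevel u<H)
    edgePosition-arc hubIn         _   rewrite onLeft-downColumn {H} ≤-refl = refl

    diagonal-sum : ∀ {u} → u ≤ H → toℕ (downColumn u) + toℕ (downLevel u) ≡ H + suc col
    diagonal-sum {u} u≤H = begin
      toℕ (downColumn u) + toℕ (downLevel u) ≡⟨ cong₂ _+_ (toℕ-downColumn u≤H) (toℕ-clamp (m∸n≤m H u)) ⟩
      (u + suc col) + (H ∸ u)               ≡⟨ +-assoc u (suc col) (H ∸ u) ⟩
      u + (suc col + (H ∸ u))               ≡⟨ cong (u +_) (+-comm (suc col) (H ∸ u)) ⟩
      u + ((H ∸ u) + suc col)               ≡⟨ sym (+-assoc u (H ∸ u) (suc col)) ⟩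
      (u + (H ∸ u)) + suc col               ≡⟨ cong (_+ suc col) (m+[n∸m]≡n u≤H) ⟩
      H + suc col                           ∎
      where open ≡-Reasoning

    owned : ∀ s → Valid s → i ∈ owners (proj₁ (arcAt s))
    owned hubOut        _   = x∈p∪q⁺ (inj₁ (∈-preimage⁺ leftKey (sym (toℕ-left i))))
    owned (upSpine y)   _   = x∈p∪q⁺ (inj₁ (∈-preimage⁺ leftKey (sym (toℕ-left i))))
    owned (upStep y)    _   = ∈-preimage⁺ leftKey (sym (toℕ-left i))
    owned fEdge         _   = x∈⁅x⁆ i
    owned (downSpine u) u≤H = x∈p∪q⁺ (inj₂ (∈-preimage⁺ rightKey (sym (diagonal-sum u≤H))))
    owned (downStep u)  u<H = ∈-preimage⁺ rightKey (begin
      H + suc col                                            ≡⟨ sym (diagonal-sum (<⇒≤ u<H)) ⟩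
      toℕ (downColumn u) + toℕ (downLevel u)                 ≡⟨ cong₂ (λ x y → toℕ x + toℕ y)
                                                                      (sym (inject₁-diagColumn u<H))
                                                                      (sym (suc-diagLevel u<H)) ⟩
      toℕ (inject₁ (diagColumn u)) + suc (toℕ (diagLevel u)) ≡⟨ cong (_+ _) (toℕ-inject₁ (diagColumn u)) ⟩
      toℕ (diagColumn u) + suc (toℕ (diagLevel u))           ∎)
      where open ≡-Reasoning
    owned hubIn         _   = x∈p∪q⁺ (inj₂ (∈-preimage⁺ rightKey (sym (toℕ-downColumn ≤-refl))))

    trail : ClosedTrail (position hubIn)
    trail = record
      { arc                   = λ t → arcAt (slot t)
      ; links                 = λ t t<L → links-nextSlot (slot t) (proj₁ (slot-valid t (<⇒≤ t<L)))
      ; closes                = subst (λ s → Links (arcAt s) (arcAt hubOut)) (sym slot-hubIn) (links-nextSlot hubIn tt)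
      ; vertexPosition        = vertexPosition
      ; edgePosition          = edgePosition
      ; vertexPosition-source = λ t t≤L → let valid , at-t = slot-valid t t≤L in
                                  trans (vertexPosition-source (slot t) valid) at-t
      ; edgePosition-arc      = λ t t≤L → let valid , at-t = slot-valid t t≤L in
                                  trans (edgePosition-arc (slot t) valid) at-t
      }

    cycle : Cycle graph
    cycle = toCycle trail

    cycle-owned : ∀ s → i ∈ owners (edgeAt (edg cycle s))
    cycle-owned s = subst (λ α → i ∈ owners (proj₁ α)) (sym (arcOf-toCycle trail s))
                          (owned (slot (toℕ s)) (proj₁ (slot-valid (toℕ s) (toℕ≤pred[n] s))))

    fEdge≤hubIn : position fEdge ≤ position hubIn
    fEdge≤hubIn = ≤-trans (double-< (s≤s (m≤m+n H H))) (≤-trans (n≤1+n _) (n≤1+n _))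

    fIndex : Fin (suc (len cycle))
    fIndex = fromℕ< (s≤s fEdge≤hubIn)

    cycle-fedge : edgeAt (edg cycle fIndex) ≡ fedge i
    cycle-fedge = begin
      edgeAt (edg cycle fIndex)          ≡⟨ cong proj₁ (arcOf-toCycle trail fIndex) ⟩
      proj₁ (arcAt (slot (toℕ fIndex)))  ≡⟨ cong (λ t → proj₁ (arcAt (slot t))) (toℕ-fromℕ< (s≤s fEdge≤hubIn)) ⟩
      proj₁ (arcAt (slot (2 + double H))) ≡⟨ cong (λ s → proj₁ (arcAt s)) slot-fEdge ⟩
      fedge i                            ∎
      where open ≡-Reasoning

  isFEdge : Edge → Bool
  isFEdge (fedge _) = true
  isFEdge _         = false

  F : Subset (m graph)
  F = tabulate (λ f → isFEdge (edgeAt f))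

  ∈F⁻ : ∀ {f} → f ∈ F → ∃ λ j → edgeAt f ≡ fedge j
  ∈F⁻ {f} f∈F = isFEdge-true (edgeAt f) (∈-tabulate⁻ {f = λ f → isFEdge (edgeAt f)} f∈F)
    where
    isFEdge-true : ∀ e → isFEdge e ≡ true → ∃ λ j → e ≡ fedge j
    isFEdge-true (fedge j) _ = j , refl
    isFEdge-true (spine _ _)    ()
    isFEdge-true (vertical _ _) ()
    isFEdge-true (diagonal _ _) ()
    isFEdge-true (hubEdge _)    ()

  ∈F⁺ : ∀ {f j} → edgeAt f ≡ fedge j → f ∈ F
  ∈F⁺ isF = ∈-tabulate⁺ {f = λ f → isFEdge (edgeAt f)} (cong isFEdge isF)

  F-packing : ∀ 𝒞 → PairwiseEdgeDisjoint 𝒞 → ∣ F ∩ E 𝒞 ∣ ≤ 1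
  F-packing = ∣F∩E∣≤1 F (λ C i∈F j∈F → F-edge-unique C (proj₂ (∈F⁻ i∈F)) (proj₂ (∈F⁻ j∈F)))
                        (λ C D C⊥D i∈F j∈F → F-edges-exclusive C D C⊥D (proj₂ (∈F⁻ i∈F)) (proj₂ (∈F⁻ j∈F)))

  F-cycle-avoiding : (X : Subset (m graph)) → ∣ X ∣ ≤ k →
                     Σ (CycleOfDeletion graph X) λ C → ∃ λ s → edg (proj₁ C) s ∈ F
  F-cycle-avoiding X ∣X∣≤k with ∃-outside-unionOver (λ f → owners (edgeAt f)) (λ f → ∣owners∣≤2 (edgeAt f)) X
                                                     (s≤s (*-monoˡ-≤ 2 ∣X∣≤k))
  ... | i , i∉ = (cycle , λ s e∈X → i∉ e∈X (cycle-owned s)) , fIndex , ∈F⁺ cycle-fedge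
    where open CycleThrough i

proposition2p8 : (k : ℕ) → Σ BiGraph λ B → Σ (Subset (m B)) λ F →
    ((𝒞 : List (Cycle B)) → PairwiseEdgeDisjoint 𝒞 → ∣ F ∩ E 𝒞 ∣ ≤ 1)
    × ((X : Subset (m B)) → ∣ X ∣ ≤ k →
        Σ (CycleOfDeletion B X) λ C → ∃ λ i → edg (proj₁ C) i ∈ F)
proposition2p8 k = graph , F , F-packing , F-cycle-avoiding
  where open Construction k
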